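{- Let $\ell\ge3$ be a prime, $1\le k\le\ell-2$, $a\in G$, and $\mathcal N_a=|\{j\in M_k: aj\notin M_k\}|$. Then $(-1)^{\mathcal N_a}=\left(\frac{a}{\ell}\right)$ (Legendre symbol).
   Context: $G=(\mathbb{Z}/\ell\mathbb{Z})^*$; for $a\in G$, $\langle a\rangle\in\{0,\dots,\ell-1\}$ is its representative. $M_k=\{j\in G:\langle j\rangle+\langle kj\rangle<\ell\}$ (for each $j\in G$, exactly one of $j,-j$ lies in $M_k$). -}

module Defs where

open import Data.Nat using (ℕ; zero; suc; _+_; _*_; _<_; _≤_; _<?_; _≟_; NonZero)
open import Data.Nat.DivMod using (_%_)
open import Data.List using (List; length; filter; upTo)
open import Data.Bool.ListAction using (any)
open import Relation.Nullary using (yes; no)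
open import Data.Bool using (Bool; true; false; if_then_else_)
open import Data.Integer using (ℤ; +_; -_; 1ℤ)
open import Relation.Nullary.Decidable using (⌊_⌋; _×-dec_; ¬?)

-- Elements of G = (ℤ/ℓℤ)^* are represented by their representatives
-- ⟨j⟩ ∈ {1,…,ℓ-1}.  The representative of an arbitrary natural x is x % ℓ.

-- j ∈ M_k  ⇔  ⟨j⟩ + ⟨k j⟩ < ℓ   (j given by a representative 1 ≤ j < ℓ)
inM : (ℓ k j : ℕ) .{{_ : NonZero ℓ}} → Bool
inM ℓ k j = ⌊ (j % ℓ) + ((k * j) % ℓ) <? ℓ ⌋

Glist : ℕ → List ℕ
Glist ℓ = filter (λ j → 1 Data.Nat.≤? j) (upTo ℓ)

𝒩 : (ℓ k a : ℕ) .{{_ : NonZero ℓ}} → ℕ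
𝒩 ℓ k a = length (filter (λ j → (inM ℓ k j Data.Bool.≟ true) ×-dec (inM ℓ k (a * j) Data.Bool.≟ false)) (Glist ℓ))

isQR : (ℓ a : ℕ) .{{_ : NonZero ℓ}} → Bool
isQR ℓ a = any (λ x → ⌊ (x * x) % ℓ ≟ a % ℓ ⌋) (upTo ℓ)

legendre : (a ℓ : ℕ) .{{_ : NonZero ℓ}} → ℤ
legendre a ℓ with a % ℓ ≟ 0
... | yes _ = + 0
... | no _ = if isQR ℓ a then 1ℤ else - 1ℤ

neg1^ : ℕ → ℤ
neg1^ zero = 1ℤ
neg1^ (suc n) = - neg1^ n

{-# OPTIONS --safe #-}
module Submission where

-- For every unit j exactly one of j and -j lies in M (this is where 1 ≤ k ≤ ℓ - 2 enters).
-- So for j ∈ M we can write a j ≡ ±σ(j) with σ(j) ∈ M, the sign being -1 exactly when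
-- a j ∉ M, and σ permutes M; multiplying over M gives Gauss's a^|M| ≡ (-1)^𝒩ₐ (mod ℓ).
-- Euler's criterion identifies a^|M| = a^((ℓ-1)/2) with (a/ℓ): for a = b² apply the same
-- identity to b, and for a non-residue pair every unit x with a/x, so that the product of all
-- units is a^|M|, while by Wilson's theorem (pair x with 1/x) it is -1.

import Algebra.Properties.CommutativeSemigroup as CommSemigroupProperties
open import Data.Bool using (Bool; true; false; not; if_then_else_; T)
import Data.Bool as Bool
open import Data.Bool.Properties using (T-≡)
open import Data.Empty using (⊥-elim)
open import Data.Integer using (-_; 1ℤ)
open import Data.List using (List; []; _∷_; map; filter; length; upTo)
open import Data.List.Membership.Propositional using (_∈_; _∉_; find; lose)
open import Data.List.Membership.Propositional.Properties
  using (∈-map⁺; ∈-map⁻; ∈-filter⁺; ∈-filter⁻; ∈-upTo⁺; ∈-upTo⁻)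
open import Data.List.Membership.Propositional.Properties.WithK using (unique∧set⇒bag)
open import Data.List.Properties using (length-map)
open import Data.List.Relation.Binary.BagAndSetEquality using (∼bag⇒↭)
open import Data.List.Relation.Binary.Permutation.Propositional using (_↭_; ↭-prep; ↭-trans)
open import Data.List.Relation.Binary.Permutation.Propositional.Properties using (↭-length)
open import Data.List.Relation.Unary.All as All using (All; []; _∷_)
open import Data.List.Relation.Unary.AllPairs using ([]; _∷_)
open import Data.List.Relation.Unary.Any using (here; there)
open import Data.List.Relation.Unary.Any.Properties using (any⁺; any⁻)
open import Data.List.Relation.Unary.Unique.Propositional using (Unique)
open import Data.List.Relation.Unary.Unique.Propositional.Properties
  using (Unique[x∷xs]⇒x∉xs; filter⁺; upTo⁺)
open import Data.Nat
  using (ℕ; zero; suc; _+_; _*_; _∸_; _^_; _≤_; _<_; z≤n; s≤s; NonZero; _≟_; _<?_; _≤?_;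
         ⌊_/2⌋; >-nonZero; >-nonZero⁻¹; nonTrivial⇒n>1)
open import Data.Nat.DivMod
  using (_%_; %-distribˡ-+; %-distribˡ-*; m%n%n≡m%n; m%n<n; m%n≤n; m<n⇒m%n≡m; [m+kn]%n≡m%n)
open import Data.Nat.Divisibility
  using (_∣_; _∤_; _∣?_; ∣-refl; ∣n⇒∣m*n; m∣m*n; n∣m*n; >⇒∤; m%n≡0⇒n∣m; n∣m⇒m%n≡0)
open import Data.Nat.Coprimality using (coprime-Bézout; prime⇒coprime)
open import Data.Nat.GCD using (module Bézout)
open import Data.Nat.ListAction using (product)
open import Data.Nat.ListAction.Properties using (product-↭)
open import Data.Nat.Primality using (Prime; euclidsLemma; prime⇒nonTrivial)
open import Data.Nat.Properties
open import Data.Nat.Tactic.RingSolver using (solve-∀)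
open import Data.Product using (∃-syntax; _×_; _,_; proj₁; proj₂)
open import Data.Sum using (_⊎_; inj₁; inj₂; [_,_]′)
open import Data.Unit using (tt)
open import Function.Base using (case_of_)
open import Function.Bundles using (mk⇔; Equivalence)
open import Relation.Nullary using (¬_; yes; no; ¬?)
open import Relation.Nullary.Decidable using (⌊_⌋; _×-dec_; toWitness; fromWitness)
open import Relation.Unary using (Decidable)
open import Relation.Binary.PropositionalEquality

open import Defs

open CommSemigroupProperties +-commutativeSemigroup using () renaming (interchange to +-interchange)
open CommSemigroupProperties *-commutativeSemigroup using (x∙yz≈y∙xz; xy∙z≈y∙xz) renaming (interchange to *-interchange)

↭-unique : {A : Set} {xs ys : List A} → Unique xs → Unique ys →
           (∀ {z} → z ∈ xs → z ∈ ys) → (∀ {z} → z ∈ ys → z ∈ xs) → xs ↭ ys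
↭-unique xs-unique ys-unique xs⊆ys ys⊆xs =
  ∼bag⇒↭ (unique∧set⇒bag xs-unique ys-unique (mk⇔ xs⊆ys ys⊆xs))

module _ {A B : Set} where

  Unique-map⁺ : (f : A → B) {xs : List A} →
                (∀ {x y} → x ∈ xs → y ∈ xs → f x ≡ f y → x ≡ y) →
                Unique xs → Unique (map f xs)
  Unique-map⁺ f {[]} _ [] = []
  Unique-map⁺ f {x ∷ xs} injective (x≢xs ∷ xs-unique) =
    All.tabulate fx≢ ∷ Unique-map⁺ f (λ x∈ y∈ → injective (there x∈) (there y∈)) xs-unique
    where
    fx≢ : ∀ {z} → z ∈ map f xs → f x ≢ z
    fx≢ z∈ fx≡z with ∈-map⁻ f z∈
    ... | y , y∈ , refl = All.lookup x≢xs y∈ (injective (here refl) (there y∈) fx≡z)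

  map-↭ : (f : A → B) {xs : List A} {ys : List B} → Unique xs → Unique ys →
          (∀ {x y} → x ∈ xs → y ∈ xs → f x ≡ f y → x ≡ y) →
          (∀ {x} → x ∈ xs → f x ∈ ys) →
          (∀ {y} → y ∈ ys → ∃[ x ] x ∈ xs × f x ≡ y) →
          map f xs ↭ ys
  map-↭ f {xs} {ys} xs-unique ys-unique injective into onto =
    ↭-unique (Unique-map⁺ f injective xs-unique) ys-unique image⊆ys ys⊆image
    where
    image⊆ys : ∀ {z} → z ∈ map f xs → z ∈ ys
    image⊆ys z∈ with ∈-map⁻ f z∈
    ... | x , x∈ , refl = into x∈
    ys⊆image : ∀ {z} → z ∈ ys → z ∈ map f xs
    ys⊆image z∈ with onto z∈
    ... | x , x∈ , refl = ∈-map⁺ f x∈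

module _ {A : Set} where

  length-filter-× : {P Q : A → Set} (P? : Decidable P) (Q? : Decidable Q) (xs : List A) →
                    length (filter (λ x → P? x ×-dec Q? x) xs) ≡ length (filter Q? (filter P? xs))
  length-filter-× P? Q? [] = refl
  length-filter-× P? Q? (x ∷ xs) with P? x
  ... | no _ with Q? x
  ...   | yes _ = length-filter-× P? Q? xs
  ...   | no _ = length-filter-× P? Q? xs
  length-filter-× P? Q? (x ∷ xs) | yes _ with Q? x
  ...   | yes _ = cong suc (length-filter-× P? Q? xs)
  ...   | no _ = length-filter-× P? Q? xs

  length-filter-true+false : (b : A → Bool) (xs : List A) →
    length (filter (λ x → b x Bool.≟ true) xs) + length (filter (λ x → b x Bool.≟ false) xs) ≡ length xs
  length-filter-true+false b [] = refl
  length-filter-true+false b (x ∷ xs) with b x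
  ... | true = cong suc (length-filter-true+false b xs)
  ... | false = trans (+-suc _ _) (cong suc (length-filter-true+false b xs))

  product-map-if : (b : A → Bool) (q : ℕ) (xs : List A) →
    product (map (λ x → if b x then 1 else q) xs) ≡ q ^ length (filter (λ x → b x Bool.≟ false) xs)
  product-map-if b q [] = refl
  product-map-if b q (x ∷ xs) with b x
  ... | true = trans (+-identityʳ _) (product-map-if b q xs)
  ... | false = cong (q *_) (product-map-if b q xs)

  product-map-* : (f g : A → ℕ) (xs : List A) →
    product (map (λ x → f x * g x) xs) ≡ product (map f xs) * product (map g xs)
  product-map-* f g [] = refl
  product-map-* f g (x ∷ xs) =
    trans (cong (f x * g x *_) (product-map-* f g xs)) (*-interchange (f x) (g x) _ _)

product-map-scale : ∀ a xs → product (map (a *_) xs) ≡ a ^ length xs * product xs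
product-map-scale a [] = refl
product-map-scale a (x ∷ xs) =
  trans (cong (a * x *_) (product-map-scale a xs)) (*-interchange a x _ _)

^-distribʳ-* : ∀ m n o → (m * n) ^ o ≡ m ^ o * n ^ o
^-distribʳ-* m n zero = refl
^-distribʳ-* m n (suc o) =
  trans (cong (m * n *_) (^-distribʳ-* m n o)) (*-interchange m n (m ^ o) (n ^ o))

m+m≡n+n⇒m≡n : ∀ {m n} → m + m ≡ n + n → m ≡ n
m+m≡n+n⇒m≡n {m} {n} eq = trans (n≡⌊n+n/2⌋ m) (trans (cong ⌊_/2⌋ eq) (sym (n≡⌊n+n/2⌋ n)))

∸+∸+[+]≡+ : ∀ {p r s} → r ≤ p → s ≤ p → (p ∸ r) + (p ∸ s) + (r + s) ≡ p + p
∸+∸+[+]≡+ {p} {r} {s} r≤p s≤p =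
  trans (+-interchange (p ∸ r) (p ∸ s) r s) (cong₂ _+_ (m∸n+n≡m r≤p) (m∸n+n≡m s≤p))

<-reflect : ∀ {p r s} → r ≤ p → s ≤ p → r + s ≢ p →
            ⌊ (p ∸ r) + (p ∸ s) <? p ⌋ ≡ not ⌊ r + s <? p ⌋
<-reflect {p} {r} {s} r≤p s≤p r+s≢p with r + s <? p | (p ∸ r) + (p ∸ s) <? p
... | yes r+s<p | yes r′+s′<p =
  ⊥-elim (<-irrefl (∸+∸+[+]≡+ r≤p s≤p) (+-mono-< r′+s′<p r+s<p))
... | yes _ | no _ = refl
... | no _ | yes _ = refl
... | no r+s≮p | no r′+s′≮p =
  ⊥-elim (<-irrefl (sym (∸+∸+[+]≡+ r≤p s≤p))
                   (+-mono-≤-< (≮⇒≥ r′+s′≮p) (≤∧≢⇒< (≮⇒≥ r+s≮p) (≢-sym r+s≢p))))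

remove : ℕ → List ℕ → List ℕ
remove x = filter (λ z → ¬? (z ≟ x))

∈-remove⁻ : ∀ {x z} xs → z ∈ remove x xs → z ∈ xs × z ≢ x
∈-remove⁻ {x} xs = ∈-filter⁻ (λ z → ¬? (z ≟ x)) {xs = xs}

∈-remove⁺ : ∀ {x z xs} → z ∈ xs → z ≢ x → z ∈ remove x xs
∈-remove⁺ {x} = ∈-filter⁺ (λ z → ¬? (z ≟ x))

Unique-remove : ∀ {x xs} → Unique xs → Unique (remove x xs)
Unique-remove {x} = filter⁺ (λ z → ¬? (z ≟ x))

↭-remove : ∀ {x xs} → Unique xs → x ∈ xs → xs ↭ x ∷ remove x xs
↭-remove {x} {xs} xs-unique x∈xs =
  ↭-unique xs-unique (All.tabulate (λ z∈ → ≢-sym (proj₂ (∈-remove⁻ xs z∈))) ∷ Unique-remove xs-unique)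
           to from
  where
  to : ∀ {z} → z ∈ xs → z ∈ x ∷ remove x xs
  to {z} z∈ with z ≟ x
  ... | yes refl = here refl
  ... | no z≢x = there (∈-remove⁺ z∈ z≢x)
  from : ∀ {z} → z ∈ x ∷ remove x xs → z ∈ xs
  from (here refl) = x∈xs
  from (there z∈) = proj₁ (∈-remove⁻ xs z∈)

record FreeInvolutionOn (f : ℕ → ℕ) (xs : List ℕ) : Set where
  field
    closed       : ∀ {x} → x ∈ xs → f x ∈ xs
    involutive   : ∀ {x} → x ∈ xs → f (f x) ≡ x
    fixpointFree : ∀ {x} → x ∈ xs → f x ≢ x

remove-pair : ∀ {f x xs} → x ∉ xs → FreeInvolutionOn f (x ∷ xs) → FreeInvolutionOn f (remove (f x) xs)
remove-pair {f} {x} {xs} x∉xs inv = record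
  { closed       = closed′
  ; involutive   = λ z∈ → involutive (there (proj₁ (∈-remove⁻ xs z∈)))
  ; fixpointFree = λ z∈ → fixpointFree (there (proj₁ (∈-remove⁻ xs z∈)))
  }
  where
  open FreeInvolutionOn inv
  closed′ : ∀ {z} → z ∈ remove (f x) xs → f z ∈ remove (f x) xs
  closed′ {z} z∈ with ∈-remove⁻ xs z∈
  ... | z∈xs , z≢fx with closed (there z∈xs)
  ...   | here fz≡x = ⊥-elim (z≢fx (trans (sym (involutive (there z∈xs))) (cong f fz≡x)))
  ...   | there fz∈xs = ∈-remove⁺ fz∈xs (λ fz≡fx → x∉xs (subst (_∈ xs) (z≡x fz≡fx) z∈xs))
    where
    z≡x : f z ≡ f x → z ≡ x
    z≡x fz≡fx = trans (sym (involutive (there z∈xs))) (trans (cong f fz≡fx) (involutive (here refl)))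

module Congruence (p : ℕ) .{{_ : NonZero p}} where

  infix 4 _≈_
  _≈_ : ℕ → ℕ → Set
  x ≈ y = x % p ≡ y % p

  %-≈ : ∀ x → x % p ≈ x
  %-≈ x = m%n%n≡m%n x p

  +-cong : ∀ {x x′ y y′} → x ≈ x′ → y ≈ y′ → x + y ≈ x′ + y′
  +-cong {x} {x′} {y} {y′} x≈x′ y≈y′ = begin
    (x + y) % p             ≡⟨ %-distribˡ-+ x y p ⟩
    (x % p + y % p) % p     ≡⟨ cong₂ (λ u v → (u + v) % p) x≈x′ y≈y′ ⟩
    (x′ % p + y′ % p) % p   ≡⟨ %-distribˡ-+ x′ y′ p ⟨
    (x′ + y′) % p           ∎
    where open ≡-Reasoning

  *-cong : ∀ {x x′ y y′} → x ≈ x′ → y ≈ y′ → x * y ≈ x′ * y′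
  *-cong {x} {x′} {y} {y′} x≈x′ y≈y′ = begin
    (x * y) % p               ≡⟨ %-distribˡ-* x y p ⟩
    ((x % p) * (y % p)) % p   ≡⟨ cong₂ (λ u v → (u * v) % p) x≈x′ y≈y′ ⟩
    ((x′ % p) * (y′ % p)) % p ≡⟨ %-distribˡ-* x′ y′ p ⟨
    (x′ * y′) % p             ∎
    where open ≡-Reasoning

  ^-cong : ∀ {x y} n → x ≈ y → x ^ n ≈ y ^ n
  ^-cong zero    _   = refl
  ^-cong (suc n) x≈y = *-cong x≈y (^-cong n x≈y)

  product-cong : ∀ {A : Set} (f g : A → ℕ) {xs} → (∀ {x} → x ∈ xs → f x ≈ g x) →
                 product (map f xs) ≈ product (map g xs)
  product-cong f g {[]}     _   = refl
  product-cong f g {x ∷ xs} f≈g = *-cong (f≈g (here refl)) (product-cong f g (λ x∈ → f≈g (there x∈)))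

  ≈⇒≡ : ∀ {x y} → x < p → y < p → x ≈ y → x ≡ y
  ≈⇒≡ x<p y<p x≈y = trans (sym (m<n⇒m%n≡m x<p)) (trans x≈y (m<n⇒m%n≡m y<p))

  0%p≡0 : 0 % p ≡ 0
  0%p≡0 = m<n⇒m%n≡m (>-nonZero⁻¹ p)

  ≈0⇒∣ : ∀ {x} → x ≈ 0 → p ∣ x
  ≈0⇒∣ {x} x≈0 = m%n≡0⇒n∣m x p (trans x≈0 0%p≡0)

  ∣⇒≈0 : ∀ {x} → p ∣ x → x ≈ 0
  ∣⇒≈0 {x} p∣x = trans (n∣m⇒m%n≡0 x p p∣x) (sym 0%p≡0)

  <p⇒∤ : ∀ {x} → 0 < x → x < p → p ∤ x
  <p⇒∤ 0<x = >⇒∤ {{>-nonZero 0<x}}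

  ∤-factor : ∀ {x y c} → x * y ≈ c → p ∤ c → p ∤ y
  ∤-factor {x} xy≈c p∤c p∣y = p∤c (≈0⇒∣ (trans (sym xy≈c) (∣⇒≈0 (∣n⇒∣m*n x p∣y))))

  -- The representative of -x; for x ≡ 0 (mod p) it is p rather than 0.
  neg : ℕ → ℕ
  neg x = p ∸ x % p

  +-neg : ∀ x → x + neg x ≈ 0
  +-neg x = begin
    (x + neg x) % p         ≡⟨ +-cong (sym (%-≈ x)) refl ⟩
    (x % p + neg x) % p     ≡⟨ cong (_% p) (m+[n∸m]≡n (m%n≤n x p)) ⟩
    p % p                   ≡⟨ ∣⇒≈0 ∣-refl ⟩
    0 % p                   ∎
    where open ≡-Reasoning

  +-cancelʳ-≈ : ∀ {u v} y → u + y ≈ v + y → u ≈ v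
  +-cancelʳ-≈ {u} {v} y u+y≈v+y = begin
    u % p                   ≡⟨ cong (_% p) (+-identityʳ u) ⟨
    (u + 0) % p             ≡⟨ +-cong {u} refl (sym (+-neg y)) ⟩
    (u + (y + neg y)) % p   ≡⟨ cong (_% p) (+-assoc u y (neg y)) ⟨
    (u + y + neg y) % p     ≡⟨ +-cong u+y≈v+y refl ⟩
    (v + y + neg y) % p     ≡⟨ cong (_% p) (+-assoc v y (neg y)) ⟩
    (v + (y + neg y)) % p   ≡⟨ +-cong {v} refl (+-neg y) ⟩
    (v + 0) % p             ≡⟨ cong (_% p) (+-identityʳ v) ⟩
    v % p                   ∎
    where open ≡-Reasoning

  neg-unique : ∀ {u y} → u + y ≈ 0 → u ≈ neg y
  neg-unique {u} {y} u+y≈0 =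
    +-cancelʳ-≈ y (trans u+y≈0 (sym (trans (cong (_% p) (+-comm (neg y) y)) (+-neg y))))

  neg-involutive : ∀ x → neg (neg x) ≈ x
  neg-involutive x = sym (neg-unique (+-neg x))

  *-neg : ∀ a x → a * neg x ≈ neg (a * x)
  *-neg a x = neg-unique (begin
    (a * neg x + a * x) % p ≡⟨ cong (_% p) (*-distribˡ-+ a (neg x) x) ⟨
    (a * (neg x + x)) % p   ≡⟨ *-cong {a} refl (trans (cong (_% p) (+-comm (neg x) x)) (+-neg x)) ⟩
    (a * 0) % p             ≡⟨ cong (_% p) (*-zeroʳ a) ⟩
    0 % p                   ∎)
    where open ≡-Reasoning

  [p∸1]*≈neg : ∀ x → (p ∸ 1) * x ≈ neg x
  [p∸1]*≈neg x = neg-unique (begin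
    ((p ∸ 1) * x + x) % p     ≡⟨ cong (λ t → ((p ∸ 1) * x + t) % p) (*-identityˡ x) ⟨
    ((p ∸ 1) * x + 1 * x) % p ≡⟨ cong (_% p) (*-distribʳ-+ x (p ∸ 1) 1) ⟨
    ((p ∸ 1 + 1) * x) % p     ≡⟨ cong (λ t → (t * x) % p) (m∸n+n≡m (>-nonZero⁻¹ p)) ⟩
    (p * x) % p               ≡⟨ ∣⇒≈0 (m∣m*n x) ⟩
    0 % p                     ∎)
    where open ≡-Reasoning

  p∸1<p : p ∸ 1 < p
  p∸1<p = ∸-monoʳ-< {p} {1} {0} (s≤s z≤n) (>-nonZero⁻¹ p)

  neg[p∸1]≡1 : neg (p ∸ 1) ≡ 1
  neg[p∸1]≡1 = trans (cong (p ∸_) (m<n⇒m%n≡m p∸1<p)) (m∸[m∸n]≡n (>-nonZero⁻¹ p))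

  sign : Bool → ℕ
  sign b = if b then 1 else p ∸ 1

  sign²≈1 : ∀ b → sign b * sign b ≈ 1
  sign²≈1 true  = refl
  sign²≈1 false = trans ([p∸1]*≈neg (p ∸ 1)) (cong (_% p) neg[p∸1]≡1)

  sign-flip : ∀ {x y} b → x ≈ sign b * y → y ≈ sign b * x
  sign-flip {x} {y} b x≈by = begin
    y % p                       ≡⟨ cong (_% p) (*-identityˡ y) ⟨
    (1 * y) % p                 ≡⟨ *-cong (sym (sign²≈1 b)) refl ⟩
    (sign b * sign b * y) % p   ≡⟨ cong (_% p) (*-assoc (sign b) (sign b) y) ⟩
    (sign b * (sign b * y)) % p ≡⟨ *-cong {sign b} refl (sym x≈by) ⟩
    (sign b * x) % p            ∎
    where open ≡-Reasoning

  [p∸1]*sign : ∀ b → (p ∸ 1) * sign b ≈ sign (not b)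
  [p∸1]*sign true  = cong (_% p) (*-identityʳ (p ∸ 1))
  [p∸1]*sign false = sign²≈1 false

  0<%-∤ : ∀ {x} → p ∤ x → 0 < x % p
  0<%-∤ {x} p∤x = n≢0⇒n>0 (λ x%p≡0 → p∤x (m%n≡0⇒n∣m x p x%p≡0))

  neg<p : ∀ {x} → p ∤ x → neg x < p
  neg<p {x} p∤x = ∸-monoʳ-< (0<%-∤ p∤x) (m%n≤n x p)

  neg-neg≡% : ∀ {x} → p ∤ x → neg (neg x) ≡ x % p
  neg-neg≡% {x} p∤x = trans (cong (p ∸_) (m<n⇒m%n≡m (neg<p p∤x))) (m∸[m∸n]≡n (m%n≤n x p))

  G : List ℕ
  G = Glist p

  ∈G⁻ : ∀ {x} → x ∈ G → 0 < x × x < p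
  ∈G⁻ x∈ with ∈-filter⁻ (λ j → 1 ≤? j) {xs = upTo p} x∈
  ... | x∈upTo , 0<x = 0<x , ∈-upTo⁻ x∈upTo

  ∈G⁺ : ∀ {x} → 0 < x → x < p → x ∈ G
  ∈G⁺ 0<x x<p = ∈-filter⁺ (λ j → 1 ≤? j) (∈-upTo⁺ x<p) 0<x

  G-unique : Unique G
  G-unique = filter⁺ (λ j → 1 ≤? j) (upTo⁺ p)

  ∈G⇒∤ : ∀ {x} → x ∈ G → p ∤ x
  ∈G⇒∤ x∈ = <p⇒∤ (proj₁ (∈G⁻ x∈)) (proj₂ (∈G⁻ x∈))

  ∈G⇒%≡ : ∀ {x} → x ∈ G → x % p ≡ x
  ∈G⇒%≡ x∈ = m<n⇒m%n≡m (proj₂ (∈G⁻ x∈))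

  %-∈G : ∀ {x} → p ∤ x → x % p ∈ G
  %-∈G {x} p∤x = ∈G⁺ (0<%-∤ p∤x) (m%n<n x p)

  neg-∈G : ∀ {x} → p ∤ x → neg x ∈ G
  neg-∈G {x} p∤x = ∈G⁺ (m<n⇒0<n∸m (m%n<n x p)) (neg<p p∤x)

  neg-neg-∈G : ∀ {x} → x ∈ G → neg (neg x) ≡ x
  neg-neg-∈G x∈ = trans (neg-neg≡% (∈G⇒∤ x∈)) (∈G⇒%≡ x∈)

  isQR-sound : ∀ {a} → isQR p a ≡ true → ∃[ x ] x < p × x * x ≈ a
  isQR-sound {a} qr with find (any⁻ (λ x → ⌊ (x * x) % p ≟ a % p ⌋) (upTo p) (subst T (sym qr) tt))
  ... | x , x∈ , x²≈a = x , ∈-upTo⁻ x∈ , toWitness x²≈a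

  isQR-complete : ∀ {a x} → x < p → x * x ≈ a → isQR p a ≡ true
  isQR-complete x<p x²≈a =
    Equivalence.to T-≡ (any⁺ _ (lose (∈-upTo⁺ x<p) (fromWitness x²≈a)))

  product-pairs : ∀ {f c} n xs → length xs ≤ n → Unique xs → FreeInvolutionOn f xs →
                  (∀ {x} → x ∈ xs → x * f x ≈ c) → ∃[ m ] length xs ≡ m + m × product xs ≈ c ^ m
  product-pairs _ [] _ _ _ _ = 0 , refl , refl
  product-pairs {f} {c} (suc n) (x ∷ xs) (s≤s |xs|≤n) (x≢xs ∷ xs-unique) inv pair =
    suc m , length-eq , product-eq
    where
    open FreeInvolutionOn inv
    x∉xs : x ∉ xs
    x∉xs = Unique[x∷xs]⇒x∉xs (x≢xs ∷ xs-unique)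
    fx∈xs : f x ∈ xs
    fx∈xs with closed (here refl)
    ... | here fx≡x = ⊥-elim (fixpointFree (here refl) fx≡x)
    ... | there fx∈ = fx∈
    rest = remove (f x) xs
    xs↭ : xs ↭ f x ∷ rest
    xs↭ = ↭-remove xs-unique fx∈xs
    |xs|≡ : length xs ≡ suc (length rest)
    |xs|≡ = ↭-length xs↭
    ih = product-pairs n rest (≤-trans (n≤1+n _) (subst (_≤ n) |xs|≡ |xs|≤n))
           (Unique-remove xs-unique) (remove-pair x∉xs inv)
           (λ z∈ → pair (there (proj₁ (∈-remove⁻ xs z∈))))
    m = proj₁ ih
    length-eq : suc (length xs) ≡ suc m + suc m
    length-eq = cong suc (trans |xs|≡ (trans (cong suc (proj₁ (proj₂ ih))) (sym (+-suc m m))))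
    product-eq : x * product xs ≈ c * c ^ m
    product-eq = begin
      (x * product xs) % p            ≡⟨ cong (λ t → (x * t) % p) (product-↭ xs↭) ⟩
      (x * (f x * product rest)) % p  ≡⟨ cong (_% p) (*-assoc x (f x) _) ⟨
      (x * f x * product rest) % p    ≡⟨ *-cong (pair (here refl)) (proj₂ (proj₂ ih)) ⟩
      (c * c ^ m) % p                 ∎
      where open ≡-Reasoning

  [p∸1]^≈sign : ∀ n → ∃[ b ] (p ∸ 1) ^ n ≈ sign b × neg1^ n ≡ (if b then 1ℤ else - 1ℤ)
  [p∸1]^≈sign zero = true , refl , refl
  [p∸1]^≈sign (suc n) with [p∸1]^≈sign n
  ... | b , pow≈ , neg1^≡ =
    not b , trans (*-cong {p ∸ 1} refl pow≈) ([p∸1]*sign b) , trans (cong -_ neg1^≡) (negate-if b)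
    where
    negate-if : ∀ b → - (if b then 1ℤ else - 1ℤ) ≡ (if not b then 1ℤ else - 1ℤ)
    negate-if true  = refl
    negate-if false = refl

  module _ (p≥3 : 3 ≤ p) where

    private
      1<p : 1 < p
      1<p = ≤-trans (s≤s (s≤s z≤n)) p≥3

    1≢p∸1 : 1 ≢ p ∸ 1
    1≢p∸1 1≡p∸1 = <-irrefl 1≡p∸1 (∸-monoˡ-≤ 1 p≥3)

    sign-injective : ∀ {b c} → sign b ≈ sign c → b ≡ c
    sign-injective {true}  {true}  _ = refl
    sign-injective {false} {false} _ = refl
    sign-injective {true}  {false} 1≈p∸1 = ⊥-elim (1≢p∸1 (≈⇒≡ 1<p p∸1<p 1≈p∸1))
    sign-injective {false} {true}  p∸1≈1 = ⊥-elim (1≢p∸1 (sym (≈⇒≡ p∸1<p 1<p p∸1≈1)))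

    neg1^-≈sign : ∀ {n} b → (p ∸ 1) ^ n ≈ sign b → neg1^ n ≡ (if b then 1ℤ else - 1ℤ)
    neg1^-≈sign {n} b pow≈b with [p∸1]^≈sign n
    ... | c , pow≈c , neg1^≡ =
      subst (λ b → neg1^ n ≡ (if b then 1ℤ else - 1ℤ)) (sign-injective (trans (sym pow≈c) pow≈b)) neg1^≡

module PrimeModulus (p : ℕ) .{{_ : NonZero p}} (prime : Prime p) where

  open Congruence p

  1<p : 1 < p
  1<p = nonTrivial⇒n>1 p {{prime⇒nonTrivial prime}}

  p∤1 : p ∤ 1
  p∤1 = >⇒∤ 1<p

  *-∤ : ∀ {x y} → p ∤ x → p ∤ y → p ∤ x * y
  *-∤ {x} {y} p∤x p∤y p∣xy = [ p∤x , p∤y ]′ (euclidsLemma x y prime p∣xy)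

  product-∤ : ∀ {xs} → All (p ∤_) xs → p ∤ product xs
  product-∤ []           = p∤1
  product-∤ (p∤x ∷ p∤xs) = *-∤ p∤x (product-∤ p∤xs)

  sign-∤ : ∀ b → p ∤ sign b
  sign-∤ true  = p∤1
  sign-∤ false = <p⇒∤ (m<n⇒0<n∸m 1<p) p∸1<p

  neg1≡p∸1 : neg 1 ≡ p ∸ 1
  neg1≡p∸1 = cong (p ∸_) (m<n⇒m%n≡m 1<p)

  ∃-inverse : ∀ {x} → p ∤ x → ∃[ y ] x * y ≈ 1
  ∃-inverse {x} p∤x with coprime-Bézout (prime⇒coprime prime {{>-nonZero (0<%-∤ p∤x)}} (m%n<n x p))
  ... | Bézout.-+ X Y 1+Xp≡Yr = Y , (begin
    (x * Y) % p          ≡⟨ *-cong (sym (%-≈ x)) refl ⟩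
    (x % p * Y) % p      ≡⟨ cong (_% p) (trans (*-comm (x % p) Y) (sym 1+Xp≡Yr)) ⟩
    (1 + X * p) % p      ≡⟨ [m+kn]%n≡m%n 1 X p ⟩
    1 % p                ∎)
    where open ≡-Reasoning
  ... | Bézout.+- X Y 1+Yr≡Xp = (p ∸ 1) * Y , (begin
    (x * ((p ∸ 1) * Y)) % p  ≡⟨ cong (_% p) (x∙yz≈y∙xz x (p ∸ 1) Y) ⟩
    ((p ∸ 1) * (x * Y)) % p  ≡⟨ *-cong {p ∸ 1} refl xY≈p∸1 ⟩
    ((p ∸ 1) * (p ∸ 1)) % p  ≡⟨ sign²≈1 false ⟩
    1 % p                    ∎)
    where
    open ≡-Reasoning
    xY+1≈0 : x * Y + 1 ≈ 0
    xY+1≈0 = begin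
      (x * Y + 1) % p        ≡⟨ +-cong (*-cong (sym (%-≈ x)) refl) refl ⟩
      (x % p * Y + 1) % p    ≡⟨ cong (_% p) (trans (+-comm _ 1) (cong (1 +_) (*-comm (x % p) Y))) ⟩
      (1 + Y * (x % p)) % p  ≡⟨ cong (_% p) 1+Yr≡Xp ⟩
      (X * p) % p            ≡⟨ ∣⇒≈0 (n∣m*n X) ⟩
      0 % p                  ∎
    xY≈p∸1 : x * Y ≈ p ∸ 1
    xY≈p∸1 = trans (neg-unique xY+1≈0) (cong (_% p) neg1≡p∸1)

  *-cancelˡ-≈ : ∀ {a x y} → p ∤ a → a * x ≈ a * y → x ≈ y
  *-cancelˡ-≈ {a} {x} {y} p∤a ax≈ay = begin
    x % p               ≡⟨ cong (_% p) (*-identityˡ x) ⟨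
    (1 * x) % p         ≡⟨ *-cong (sym ab≈1) refl ⟩
    (a * b * x) % p     ≡⟨ cong (_% p) (xy∙z≈y∙xz a b x) ⟩
    (b * (a * x)) % p   ≡⟨ *-cong {b} refl ax≈ay ⟩
    (b * (a * y)) % p   ≡⟨ cong (_% p) (xy∙z≈y∙xz a b y) ⟨
    (a * b * y) % p     ≡⟨ *-cong ab≈1 refl ⟩
    (1 * y) % p         ≡⟨ cong (_% p) (*-identityˡ y) ⟩
    y % p               ∎
    where
    open ≡-Reasoning
    b = proj₁ (∃-inverse p∤a)
    ab≈1 = proj₂ (∃-inverse p∤a)

  [x+1][x-1]≈0 : ∀ {x} → x * x ≈ 1 → (x + 1) * (x + (p ∸ 1)) ≈ 0
  [x+1][x-1]≈0 {x} x²≈1 = begin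
    ((x + 1) * (x + q)) % p         ≡⟨ cong (_% p) (expand x q) ⟩
    (x * x + q + x * (q + 1)) % p   ≡⟨ cong (λ t → (x * x + q + x * t) % p) q+1≡p ⟩
    (x * x + q + x * p) % p         ≡⟨ [m+kn]%n≡m%n (x * x + q) x p ⟩
    (x * x + q) % p                 ≡⟨ +-cong x²≈1 refl ⟩
    (1 + q) % p                     ≡⟨ cong (_% p) (trans (+-comm 1 q) q+1≡p) ⟩
    p % p                           ≡⟨ ∣⇒≈0 ∣-refl ⟩
    0 % p                           ∎
    where
    open ≡-Reasoning
    q = p ∸ 1
    q+1≡p : q + 1 ≡ p
    q+1≡p = m∸n+n≡m (>-nonZero⁻¹ p)
    expand : ∀ x q → (x + 1) * (x + q) ≡ x * x + q + x * (q + 1)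
    expand = solve-∀

  square≈1 : ∀ {x} → x * x ≈ 1 → x ≈ 1 ⊎ x ≈ p ∸ 1
  square≈1 {x} x²≈1 with euclidsLemma (x + 1) (x + (p ∸ 1)) prime (≈0⇒∣ ([x+1][x-1]≈0 {x} x²≈1))
  ... | inj₁ p∣x+1 = inj₂ (trans (neg-unique (∣⇒≈0 p∣x+1)) (cong (_% p) neg1≡p∸1))
  ... | inj₂ p∣x-1 = inj₁ (trans (neg-unique (∣⇒≈0 p∣x-1)) (cong (_% p) neg[p∸1]≡1))

  inverse : ℕ → ℕ
  inverse x with p ∣? x
  ... | yes _   = 0
  ... | no p∤x  = proj₁ (∃-inverse p∤x)

  *-inverse : ∀ {x} → p ∤ x → x * inverse x ≈ 1
  *-inverse {x} p∤x with p ∣? x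
  ... | yes p∣x  = ⊥-elim (p∤x p∣x)
  ... | no p∤x′  = proj₂ (∃-inverse p∤x′)

  infixl 7 _∕_
  _∕_ : ℕ → ℕ → ℕ
  c ∕ x = (c * inverse x) % p

  *-∕ : ∀ {x} c → p ∤ x → x * (c ∕ x) ≈ c
  *-∕ {x} c p∤x = begin
    (x * (c ∕ x)) % p           ≡⟨ *-cong {x} refl (%-≈ _) ⟩
    (x * (c * inverse x)) % p   ≡⟨ cong (_% p) (x∙yz≈y∙xz x c _) ⟩
    (c * (x * inverse x)) % p   ≡⟨ *-cong {c} refl (*-inverse p∤x) ⟩
    (c * 1) % p                 ≡⟨ cong (_% p) (*-identityʳ c) ⟩
    c % p                       ∎
    where open ≡-Reasoning

  ∕-∈G : ∀ {c x} → p ∤ c → p ∤ x → c ∕ x ∈ G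
  ∕-∈G {c} {x} p∤c p∤x = %-∈G (*-∤ p∤c (∤-factor {x} (*-inverse p∤x) p∤1))

  ∕-unique : ∀ {c y z} → p ∤ y → y * z ≈ c → z < p → c ∕ y ≡ z
  ∕-unique {c} p∤y yz≈c z<p =
    ≈⇒≡ (m%n<n _ p) z<p (*-cancelˡ-≈ p∤y (trans (*-∕ c p∤y) (sym yz≈c)))

  ∕-involutive : ∀ {c x} → p ∤ c → x ∈ G → c ∕ (c ∕ x) ≡ x
  ∕-involutive {c} {x} p∤c x∈G =
    ∕-unique (∈G⇒∤ (∕-∈G p∤c p∤x)) (trans (cong (_% p) (*-comm (c ∕ x) x)) (*-∕ c p∤x)) (proj₂ (∈G⁻ x∈G))
    where p∤x = ∈G⇒∤ x∈G

  ∕-≡-root : ∀ {c x e} → p ∤ c → x ∈ G → c ∕ x ≡ e → e * e ≈ c → x ≡ e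
  ∕-≡-root {c} {x} {e} p∤c x∈G c∕x≡e e²≈c = begin
    x             ≡⟨ ∕-involutive p∤c x∈G ⟨
    c ∕ (c ∕ x)   ≡⟨ cong (c ∕_) c∕x≡e ⟩
    c ∕ e         ≡⟨ ∕-unique (∈G⇒∤ e∈G) e²≈c (proj₂ (∈G⁻ e∈G)) ⟩
    e             ∎
    where
    open ≡-Reasoning
    e∈G = subst (_∈ G) c∕x≡e (∕-∈G p∤c (∈G⇒∤ x∈G))

  product-∕-pairs : ∀ {c xs} → p ∤ c → Unique xs → (∀ {x} → x ∈ xs → x ∈ G) →
                    (∀ {x} → x ∈ xs → c ∕ x ∈ xs) → (∀ {x} → x ∈ xs → ¬ x * x ≈ c) →
                    ∃[ m ] length xs ≡ m + m × product xs ≈ c ^ m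
  product-∕-pairs {c} {xs} p∤c xs-unique xs⊆G closed no-root =
    product-pairs (length xs) xs ≤-refl xs-unique pairing (λ x∈ → *-∕ c (∈G⇒∤ (xs⊆G x∈)))
    where
    pairing : FreeInvolutionOn (c ∕_) xs
    pairing = record
      { closed       = closed
      ; involutive   = λ x∈ → ∕-involutive p∤c (xs⊆G x∈)
      ; fixpointFree = λ {x} x∈ c∕x≡x →
          no-root x∈ (subst (λ y → x * y ≈ c) c∕x≡x (*-∕ c (∈G⇒∤ (xs⊆G x∈))))
      }

  wilson : 3 ≤ p → product G ≈ p ∸ 1
  wilson p≥3 = begin
    product G % p                      ≡⟨ cong (_% p) (product-↭ G↭) ⟩
    (1 * ((p ∸ 1) * product G₂)) % p   ≡⟨ cong (_% p) (*-identityˡ _) ⟩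
    ((p ∸ 1) * product G₂) % p         ≡⟨ *-cong {p ∸ 1} refl (proj₂ (proj₂ pairs)) ⟩
    ((p ∸ 1) * 1 ^ proj₁ pairs) % p    ≡⟨ cong (λ t → ((p ∸ 1) * t) % p) (^-zeroˡ (proj₁ pairs)) ⟩
    ((p ∸ 1) * 1) % p                  ≡⟨ cong (_% p) (*-identityʳ (p ∸ 1)) ⟩
    (p ∸ 1) % p                        ∎
    where
    open ≡-Reasoning
    G₁ = remove 1 G
    G₂ = remove (p ∸ 1) G₁
    G₂-unique : Unique G₂
    G₂-unique = Unique-remove (Unique-remove G-unique)
    G↭ : G ↭ 1 ∷ (p ∸ 1) ∷ G₂
    G↭ = ↭-trans (↭-remove G-unique (∈G⁺ (s≤s z≤n) 1<p))
                 (↭-prep 1 (↭-remove (Unique-remove G-unique)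
                                     (∈-remove⁺ (∈G⁺ (m<n⇒0<n∸m 1<p) p∸1<p) (≢-sym (1≢p∸1 p≥3)))))
    ∈G₂⁻ : ∀ {x} → x ∈ G₂ → x ∈ G × x ≢ 1 × x ≢ p ∸ 1
    ∈G₂⁻ x∈ with ∈-remove⁻ G₁ x∈
    ... | x∈G₁ , x≢p∸1 with ∈-remove⁻ G x∈G₁
    ...   | x∈G , x≢1 = x∈G , x≢1 , x≢p∸1
    closed : ∀ {x} → x ∈ G₂ → 1 ∕ x ∈ G₂
    closed x∈ with ∈G₂⁻ x∈
    ... | x∈G , x≢1 , x≢p∸1 =
      ∈-remove⁺ (∈-remove⁺ (∕-∈G p∤1 (∈G⇒∤ x∈G)) (λ 1∕x≡1 → x≢1 (∕-≡-root p∤1 x∈G 1∕x≡1 refl)))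
                (λ 1∕x≡p∸1 → x≢p∸1 (∕-≡-root p∤1 x∈G 1∕x≡p∸1 (sign²≈1 false)))
    no-root : ∀ {x} → x ∈ G₂ → ¬ x * x ≈ 1
    no-root x∈ x²≈1 with ∈G₂⁻ x∈ | square≈1 x²≈1
    ... | x∈G , x≢1 , _ | inj₁ x≈1 = x≢1 (≈⇒≡ (proj₂ (∈G⁻ x∈G)) 1<p x≈1)
    ... | x∈G , _ , x≢p∸1 | inj₂ x≈p∸1 = x≢p∸1 (≈⇒≡ (proj₂ (∈G⁻ x∈G)) p∸1<p x≈p∸1)
    pairs = product-∕-pairs p∤1 G₂-unique (λ x∈ → proj₁ (∈G₂⁻ x∈)) closed no-root

  product-G-nonresidue : ∀ {a} → p ∤ a → (∀ x → x < p → ¬ x * x ≈ a) →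
                         ∃[ m ] length G ≡ m + m × product G ≈ a ^ m
  product-G-nonresidue p∤a no-root =
    product-∕-pairs p∤a G-unique (λ x∈ → x∈) (λ x∈ → ∕-∈G p∤a (∈G⇒∤ x∈))
                    (λ x∈ → no-root _ (proj₂ (∈G⁻ x∈)))

module HalfSystem (p : ℕ) .{{_ : NonZero p}} (prime : Prime p) (p≥3 : 3 ≤ p)
                  (k : ℕ) (k≥1 : 1 ≤ k) (k≤p∸2 : k ≤ p ∸ 2) where

  open Congruence p
  open PrimeModulus p prime

  inM-cong : ∀ {x y} → x ≈ y → inM p k x ≡ inM p k y
  inM-cong x≈y = cong₂ (λ u v → ⌊ u + v <? p ⌋) x≈y (*-cong {k} refl x≈y)

  1+k<p : 1 + k < p
  1+k<p = ≤-trans (subst (_≤ p ∸ 2 + 2) (+-comm k 2) (+-monoˡ-≤ 2 k≤p∸2))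
                  (≤-reflexive (m∸n+n≡m (≤-trans (s≤s (s≤s z≤n)) p≥3)))

  p∤k : p ∤ k
  p∤k = <p⇒∤ k≥1 (<-trans (n<1+n k) 1+k<p)

  inM-neg : ∀ {x} → p ∤ x → inM p k (neg x) ≡ not (inM p k x)
  inM-neg {x} p∤x = begin
    ⌊ neg x % p + (k * neg x) % p <? p ⌋
      ≡⟨ cong₂ (λ u v → ⌊ u + v <? p ⌋) (m<n⇒m%n≡m (neg<p p∤x))
               (trans (*-neg k x) (m<n⇒m%n≡m (neg<p (*-∤ p∤k p∤x)))) ⟩
    ⌊ neg x + neg (k * x) <? p ⌋
      ≡⟨ <-reflect (m%n≤n x p) (m%n≤n (k * x) p) r+s≢p ⟩
    not (inM p k x)
      ∎
    where
    open ≡-Reasoning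
    r+s≢p : x % p + (k * x) % p ≢ p
    r+s≢p r+s≡p = *-∤ (<p⇒∤ (s≤s z≤n) 1+k<p) p∤x (≈0⇒∣ (begin
      ((1 + k) * x) % p           ≡⟨ +-cong (sym (%-≈ x)) (sym (%-≈ (k * x))) ⟩
      (x % p + (k * x) % p) % p   ≡⟨ cong (_% p) r+s≡p ⟩
      p % p                       ≡⟨ ∣⇒≈0 ∣-refl ⟩
      0 % p                       ∎))

  M : List ℕ
  M = filter (λ j → inM p k j Bool.≟ true) G

  Mᶜ : List ℕ
  Mᶜ = filter (λ j → inM p k j Bool.≟ false) G

  ∈M⁻ : ∀ {j} → j ∈ M → j ∈ G × inM p k j ≡ true
  ∈M⁻ = ∈-filter⁻ (λ j → inM p k j Bool.≟ true) {xs = G}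

  ∈M⁺ : ∀ {j} → j ∈ G → inM p k j ≡ true → j ∈ M
  ∈M⁺ = ∈-filter⁺ (λ j → inM p k j Bool.≟ true)

  ∈Mᶜ⁻ : ∀ {j} → j ∈ Mᶜ → j ∈ G × inM p k j ≡ false
  ∈Mᶜ⁻ = ∈-filter⁻ (λ j → inM p k j Bool.≟ false) {xs = G}

  ∈Mᶜ⁺ : ∀ {j} → j ∈ G → inM p k j ≡ false → j ∈ Mᶜ
  ∈Mᶜ⁺ = ∈-filter⁺ (λ j → inM p k j Bool.≟ false)

  M-unique : Unique M
  M-unique = filter⁺ (λ j → inM p k j Bool.≟ true) G-unique

  Mᶜ-unique : Unique Mᶜ
  Mᶜ-unique = filter⁺ (λ j → inM p k j Bool.≟ false) G-unique

  ∈M⇒∤ : ∀ {j} → j ∈ M → p ∤ j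
  ∈M⇒∤ j∈ = ∈G⇒∤ (proj₁ (∈M⁻ j∈))

  |M|+|M|≡|G| : length M + length M ≡ length G
  |M|+|M|≡|G| = begin
    length M + length M   ≡⟨ cong (length M +_) (trans (sym (length-map neg M)) (↭-length negM↭Mᶜ)) ⟩
    length M + length Mᶜ  ≡⟨ length-filter-true+false (λ j → inM p k j) G ⟩
    length G              ∎
    where
    open ≡-Reasoning
    negM↭Mᶜ : map neg M ↭ Mᶜ
    negM↭Mᶜ = map-↭ neg M-unique Mᶜ-unique
      (λ i∈ j∈ negi≡negj → trans (sym (neg-neg-∈G (proj₁ (∈M⁻ i∈))))
                                 (trans (cong neg negi≡negj) (neg-neg-∈G (proj₁ (∈M⁻ j∈)))))
      (λ j∈ → ∈Mᶜ⁺ (neg-∈G (∈M⇒∤ j∈)) (trans (inM-neg (∈M⇒∤ j∈)) (cong not (proj₂ (∈M⁻ j∈)))))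
      (λ j∈ → let j∈G , inM[j]≡false = ∈Mᶜ⁻ j∈ in
              neg _ , ∈M⁺ (neg-∈G (∈G⇒∤ j∈G)) (trans (inM-neg (∈G⇒∤ j∈G)) (cong not inM[j]≡false)) ,
              neg-neg-∈G j∈G)

  rep : ℕ → ℕ
  rep x = if inM p k x then x % p else neg x

  rep-cong : ∀ {x y} → x ≈ y → rep x ≡ rep y
  rep-cong x≈y = cong₂ (λ b r → if b then r else p ∸ r) (inM-cong x≈y) x≈y

  rep-true : ∀ {x} → inM p k x ≡ true → rep x ≡ x % p
  rep-true {x} = cong (λ b → if b then x % p else neg x)

  rep-false : ∀ {x} → inM p k x ≡ false → rep x ≡ neg x
  rep-false {x} = cong (λ b → if b then x % p else neg x)

  ≈sign*rep : ∀ x → x ≈ sign (inM p k x) * rep x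
  ≈sign*rep x with inM p k x
  ... | true  = sym (trans (cong (_% p) (*-identityˡ (x % p))) (%-≈ x))
  ... | false = sym (trans ([p∸1]*≈neg (neg x)) (neg-involutive x))

  rep-∈M : ∀ {x} → p ∤ x → rep x ∈ M
  rep-∈M {x} p∤x with inM p k x in eq
  ... | true  = ∈M⁺ (%-∈G p∤x) (trans (inM-cong (%-≈ x)) eq)
  ... | false = ∈M⁺ (neg-∈G p∤x) (trans (inM-neg p∤x) (cong not eq))

  rep-neg : ∀ {x} → p ∤ x → rep (neg x) ≡ rep x
  rep-neg {x} p∤x with inM p k x in eq
  ... | true  = trans (rep-false (trans (inM-neg p∤x) (cong not eq))) (neg-neg≡% p∤x)
  ... | false = trans (rep-true (trans (inM-neg p∤x) (cong not eq))) (m<n⇒m%n≡m (neg<p p∤x))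

  rep-sign* : ∀ b {x} → p ∤ x → rep (sign b * x) ≡ rep x
  rep-sign* true  {x} _   = cong rep (*-identityˡ x)
  rep-sign* false {x} p∤x = trans (rep-cong ([p∸1]*≈neg x)) (rep-neg p∤x)

  rep-∈M-id : ∀ {j} → j ∈ M → rep j ≡ j
  rep-∈M-id j∈ = trans (rep-true (proj₂ (∈M⁻ j∈))) (∈G⇒%≡ (proj₁ (∈M⁻ j∈)))

  module _ {a : ℕ} (p∤a : p ∤ a) where

    σ : ℕ → ℕ
    σ j = rep (a * j)

    ε : ℕ → ℕ
    ε j = sign (inM p k (a * j))

    σ-injective : ∀ {i j} → i ∈ M → j ∈ M → σ i ≡ σ j → i ≡ j
    σ-injective {i} {j} i∈ j∈ σi≡σj = begin
      i                     ≡⟨ rep-∈M-id i∈ ⟨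
      rep i                 ≡⟨ rep-cong i≈±j ⟩
      rep (ε i * (ε j * j)) ≡⟨ rep-sign* (inM p k (a * i)) (*-∤ (sign-∤ (inM p k (a * j))) (∈M⇒∤ j∈)) ⟩
      rep (ε j * j)         ≡⟨ rep-sign* (inM p k (a * j)) (∈M⇒∤ j∈) ⟩
      rep j                 ≡⟨ rep-∈M-id j∈ ⟩
      j                     ∎
      where
      open ≡-Reasoning
      i≈±j : i ≈ ε i * (ε j * j)
      i≈±j = *-cancelˡ-≈ p∤a (begin
        (a * i) % p                 ≡⟨ ≈sign*rep (a * i) ⟩
        (ε i * σ i) % p             ≡⟨ cong (λ r → (ε i * r) % p) σi≡σj ⟩
        (ε i * σ j) % p             ≡⟨ *-cong {ε i} refl (sign-flip (inM p k (a * j)) (≈sign*rep (a * j))) ⟩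
        (ε i * (ε j * (a * j))) % p ≡⟨ cong (λ t → (ε i * t) % p) (x∙yz≈y∙xz (ε j) a j) ⟩
        (ε i * (a * (ε j * j))) % p ≡⟨ cong (_% p) (x∙yz≈y∙xz (ε i) a _) ⟩
        (a * (ε i * (ε j * j))) % p ∎)

    σ-surjective : ∀ {m} → m ∈ M → ∃[ j ] j ∈ M × σ j ≡ m
    σ-surjective {m} m∈ = rep t , rep-∈M p∤t , (begin
      σ (rep t)      ≡⟨ rep-cong a·rep[t]≈±m ⟩
      rep (ε′ * m)   ≡⟨ rep-sign* (inM p k t) (∈M⇒∤ m∈) ⟩
      rep m          ≡⟨ rep-∈M-id m∈ ⟩
      m              ∎)
      where
      open ≡-Reasoning
      b = proj₁ (∃-inverse p∤a)
      t = b * m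
      ε′ = sign (inM p k t)
      p∤t : p ∤ t
      p∤t = *-∤ (∤-factor {a} (proj₂ (∃-inverse p∤a)) p∤1) (∈M⇒∤ m∈)
      a·rep[t]≈±m : a * rep t ≈ ε′ * m
      a·rep[t]≈±m = begin
        (a * rep t) % p         ≡⟨ *-cong {a} refl (sign-flip (inM p k t) (≈sign*rep t)) ⟩
        (a * (ε′ * t)) % p      ≡⟨ cong (_% p) (x∙yz≈y∙xz a ε′ t) ⟩
        (ε′ * (a * t)) % p      ≡⟨ cong (λ u → (ε′ * u) % p) (*-assoc a b m) ⟨
        (ε′ * (a * b * m)) % p  ≡⟨ *-cong {ε′} refl (*-cong (proj₂ (∃-inverse p∤a)) refl) ⟩
        (ε′ * (1 * m)) % p      ≡⟨ cong (λ u → (ε′ * u) % p) (*-identityˡ m) ⟩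
        (ε′ * m) % p            ∎

    σ-↭ : map σ M ↭ M
    σ-↭ = map-↭ σ M-unique M-unique σ-injective (λ j∈ → rep-∈M (*-∤ p∤a (∈M⇒∤ j∈))) σ-surjective

    gauss-lemma : a ^ length M ≈ (p ∸ 1) ^ 𝒩 p k a
    gauss-lemma = *-cancelˡ-≈ (product-∤ (All.tabulate ∈M⇒∤)) (begin
      (Π * a ^ length M) % p
        ≡⟨ cong (_% p) (trans (*-comm Π _) (sym (product-map-scale a M))) ⟩
      product (map (a *_) M) % p
        ≡⟨ product-cong (a *_) (λ j → ε j * σ j) {M} (λ {j} _ → ≈sign*rep (a * j)) ⟩
      product (map (λ j → ε j * σ j) M) % p
        ≡⟨ cong (_% p) (product-map-* ε σ M) ⟩
      (product (map ε M) * product (map σ M)) % p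
        ≡⟨ cong₂ (λ u v → (u * v) % p) (product-map-if (λ j → inM p k (a * j)) (p ∸ 1) M) (product-↭ σ-↭) ⟩
      ((p ∸ 1) ^ length (filter (λ j → inM p k (a * j) Bool.≟ false) M) * Π) % p
        ≡⟨ cong (λ n → ((p ∸ 1) ^ n * Π) % p)
                (length-filter-× (λ j → inM p k j Bool.≟ true) (λ j → inM p k (a * j) Bool.≟ false) G) ⟨
      ((p ∸ 1) ^ 𝒩 p k a * Π) % p
        ≡⟨ cong (_% p) (*-comm _ Π) ⟩
      (Π * (p ∸ 1) ^ 𝒩 p k a) % p
        ∎)
      where
      open ≡-Reasoning
      Π = product M

  euler-criterion-residue : ∀ {a b} → p ∤ a → b * b ≈ a → a ^ length M ≈ 1
  euler-criterion-residue {a} {b} p∤a b²≈a = begin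
    (a ^ h) % p                        ≡⟨ ^-cong h (sym b²≈a) ⟩
    ((b * b) ^ h) % p                  ≡⟨ cong (_% p) (^-distribʳ-* b b h) ⟩
    (b ^ h * b ^ h) % p                ≡⟨ *-cong (gauss-lemma p∤b) (gauss-lemma p∤b) ⟩
    ((p ∸ 1) ^ N * (p ∸ 1) ^ N) % p    ≡⟨ cong (_% p) (^-distribʳ-* (p ∸ 1) (p ∸ 1) N) ⟨
    (((p ∸ 1) * (p ∸ 1)) ^ N) % p      ≡⟨ ^-cong N (sign²≈1 false) ⟩
    (1 ^ N) % p                        ≡⟨ cong (_% p) (^-zeroˡ N) ⟩
    1 % p                              ∎
    where
    open ≡-Reasoning
    h = length M
    p∤b = ∤-factor {b} b²≈a p∤a
    N = 𝒩 p k b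

  euler-criterion-nonresidue : ∀ {a} → p ∤ a → (∀ x → x < p → ¬ x * x ≈ a) → a ^ length M ≈ p ∸ 1
  euler-criterion-nonresidue {a} p∤a no-root with product-G-nonresidue p∤a no-root
  ... | m , |G|≡m+m , ΠG≈aᵐ = begin
    (a ^ length M) % p   ≡⟨ cong (λ n → (a ^ n) % p) m≡|M| ⟨
    (a ^ m) % p          ≡⟨ ΠG≈aᵐ ⟨
    product G % p        ≡⟨ wilson p≥3 ⟩
    (p ∸ 1) % p          ∎
    where
    open ≡-Reasoning
    m≡|M| : m ≡ length M
    m≡|M| = m+m≡n+n⇒m≡n (trans (sym |G|≡m+m) (sym |M|+|M|≡|G|))

  euler-criterion : ∀ {a} → p ∤ a → a ^ length M ≈ sign (isQR p a)
  euler-criterion {a} p∤a with isQR p a in qr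
  ... | true  = let b , _ , b²≈a = isQR-sound qr in euler-criterion-residue {b = b} p∤a b²≈a
  ... | false = euler-criterion-nonresidue p∤a (λ x x<p x²≈a → case trans (sym (isQR-complete x<p x²≈a)) qr of λ ())

legendre-unit : ∀ {p a} .{{_ : NonZero p}} → p ∤ a → legendre a p ≡ (if isQR p a then 1ℤ else - 1ℤ)
legendre-unit {p} {a} p∤a with a % p ≟ 0
... | yes a%p≡0 = ⊥-elim (p∤a (m%n≡0⇒n∣m a p a%p≡0))
... | no _      = refl

lemma3p10 : (ℓ k a : ℕ) .{{_ : NonZero ℓ}} → Prime ℓ → 3 ≤ ℓ → 1 ≤ k → k ≤ ℓ ∸ 2 →
    1 ≤ a → a < ℓ → neg1^ (𝒩 ℓ k a) ≡ legendre a ℓ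
lemma3p10 ℓ k a ℓ-prime ℓ≥3 k≥1 k≤ℓ∸2 a≥1 a<ℓ = begin
  neg1^ (𝒩 ℓ k a)                  ≡⟨ neg1^-≈sign ℓ≥3 {𝒩 ℓ k a} (isQR ℓ a) (trans (sym (gauss-lemma ℓ∤a)) (euler-criterion ℓ∤a)) ⟩
  (if isQR ℓ a then 1ℤ else - 1ℤ)  ≡⟨ legendre-unit ℓ∤a ⟨
  legendre a ℓ                     ∎
  where
  open ≡-Reasoning
  open Congruence ℓ
  open HalfSystem ℓ ℓ-prime ℓ≥3 k k≥1 k≤ℓ∸2
  ℓ∤a : ℓ ∤ a
  ℓ∤a = <p⇒∤ a≥1 a<ℓ
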